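{- Let $i\in\{0,2\}$. Let $f$, $g$ be functions (for $i=0$, with a common codomain $\underline{Z}$) such that neither $f\leq_i g$ nor $g\leq_i f$ holds, and let $h$ be a function that is an infimum (greatest lower bound) of $f$ and $g$ with respect to $\leq_i$ among functions (in $\mathbb{F}_i$). Then the problem $\{h\}$ is not an infimum of $\{f\}$ and $\{g\}$ with respect to $\leq_i$ among problems (in $\mathbb{P}_i$). In particular, binary infima in $(\mathbb{F}_i,\leq_i)$ are in general not binary infima in $(\mathbb{P}_i,\leq_i)$.
   Context: A partial function $F:\subseteq X\to Y$ is a function from $\operatorname{dom}(F)\subseteq X$ to $Y$; it is continuous if continuous on its domain with the subspace topology. A problem $P:\underline{X}\to\underline{Y}$ is a set of partial functions from $\underline{X}$ to $\underline{Y}$; a function $f$ is identified with the problem $\{f\}$. $\leq_2$ on problems: for $P:\underline{X}_1\to\underline{Y}_1$, $Q:\underline{X}_2\to\underline{Y}_2$, $P\leq_2 Q$ iff there are continuous partial $F:\subseteq\underline{X}_1\times\underline{Y}_2\to\underline{Y}_1$, $G:\subseteq\underline{X}_1\to\underline{X}_2$ with $(x\mapsto F(x,g(G(x))))\in P$ for all $g\in Q$. $\leq_0$ on problems with common codomain $\underline{Z}$: for $P:\underline{X}\to\underline{Z}$, $Q:\underline{Y}\to\underline{Z}$, $P\leq_0 Q$ iff there is a continuous partial $G:\subseteq\underline{X}\to\underline{Y}$ with $g\circ G\in P$ for all $g\in Q$. For functions (singleton problems) these give the usual $\leq_2$ (resp. $\leq_0$: $f=g\circ G$ with $G$ continuous).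 $\mathbb{F}_i$ and $\mathbb{P}_i$ are the classes of $\leq_i$-equivalence classes of functions, respectively problems. -}

module Defs where

open import Level using (Lift; suc; zero)
open import Data.Unit using (⊤; tt)
open import Data.Product using (Σ; _×_; _,_; proj₁; proj₂)
open import Relation.Binary.PropositionalEquality using (_≡_; refl; cong)

record Space : Set₂ where
  field
    Carrier    : Set
    IsOpen     : (Carrier → Set) → Set₁
    open-ext   : (U V : Carrier → Set) → (∀ x → (U x → V x) × (V x → U x)) →
                 IsOpen U → IsOpen V
    open-whole : IsOpen (λ _ → ⊤)
    open-∩     : (U V : Carrier → Set) → IsOpen U → IsOpen V →
                 IsOpen (λ x → U x × V x)
    open-⋃     : (I : Set) (U : I → Carrier → Set) → (∀ i → IsOpen (U i)) →
                 IsOpen (λ x → Σ I (λ i → U i x))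

open Space public

_⊗_ : Space → Space → Space
X ⊗ Y = record
  { Carrier    = Carrier X × Carrier Y
  ; IsOpen     = Op
  ; open-ext   = λ U V eq oU z v → ext U V eq oU z v
  ; open-whole = λ z _ → (λ _ → ⊤) , (λ _ → ⊤) , open-whole X , open-whole Y
                          , tt , tt , (λ _ _ _ _ → tt)
  ; open-∩     = inter
  ; open-⋃     = union
  }
  where
  Op : (Carrier X × Carrier Y → Set) → Set₁
  Op W = ∀ z → W z →
         Σ (Carrier X → Set) λ U → Σ (Carrier Y → Set) λ V →
         IsOpen X U × IsOpen Y V × U (proj₁ z) × V (proj₂ z) ×
         (∀ x y → U x → V y → W (x , y))

  ext : (U V : Carrier X × Carrier Y → Set) →
        (∀ z → (U z → V z) × (V z → U z)) → Op U → Op V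
  ext U V eq oU z v with oU z (proj₂ (eq z) v)
  ... | A , B , oA , oB , a , b , sub =
        A , B , oA , oB , a , b , λ x y p q → proj₁ (eq (x , y)) (sub x y p q)

  inter : (U V : Carrier X × Carrier Y → Set) → Op U → Op V →
          Op (λ z → U z × V z)
  inter U V oU oV z (u , v) with oU z u | oV z v
  ... | A , B , oA , oB , a , b , sub | A' , B' , oA' , oB' , a' , b' , sub' =
        (λ x → A x × A' x) , (λ y → B y × B' y)
        , open-∩ X A A' oA oA' , open-∩ Y B B' oB oB'
        , (a , a') , (b , b')
        , λ x y p q → sub x y (proj₁ p) (proj₁ q) , sub' x y (proj₂ p) (proj₂ q)

  union : (I : Set) (U : I → Carrier X × Carrier Y → Set) →
          (∀ i → Op (U i)) → Op (λ z → Σ I (λ i → U i z))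
  union I U oU z (i , u) with oU i z u
  ... | A , B , oA , oB , a , b , sub =
        A , B , oA , oB , a , b , λ x y p q → i , sub x y p q

record PFun (X Y : Space) : Set₁ where
  field
    dom : Carrier X → Set
    app : (x : Carrier X) → dom x → Carrier Y
    irr : ∀ x (d d' : dom x) → app x d ≡ app x d'

open PFun public

-- Continuity on the domain w.r.t. the subspace topology:
-- every preimage of an open set is (open) ∩ dom.
Continuous : {X Y : Space} → PFun X Y → Set₁
Continuous {X} {Y} F =
  (V : Carrier Y → Set) → IsOpen Y V →
  Σ (Carrier X → Set) λ U → IsOpen X U ×
    (∀ x (d : dom F x) → (V (app F x d) → U x) × (U x → V (app F x d)))

_≈ₚ_ : {X Y : Space} → PFun X Y → PFun X Y → Set
_≈ₚ_ {X} F G =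
  (∀ x → (dom F x → dom G x) × (dom G x → dom F x)) ×
  (∀ x (d : dom F x) (e : dom G x) → app F x d ≡ app G x e)

appCong : {X Y : Space} (F : PFun X Y) {a b : Carrier X} → a ≡ b →
          (d : dom F a) (e : dom F b) → app F a d ≡ app F b e
appCong F {a} refl d e = irr F a d e

_∘ₚ_ : {X Y Z : Space} → PFun Y Z → PFun X Y → PFun X Z
g ∘ₚ G = record
  { dom = λ x → Σ (dom G x) λ d → dom g (app G x d)
  ; app = λ x de → app g (app G x (proj₁ de)) (proj₂ de)
  ; irr = λ x de de' → appCong g (irr G x (proj₁ de) (proj₁ de')) (proj₂ de) (proj₂ de')
  }

compose₂ : {X₁ Y₁ X₂ Y₂ : Space} →
           PFun (X₁ ⊗ Y₂) Y₁ → PFun X₁ X₂ → PFun X₂ Y₂ → PFun X₁ Y₁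
compose₂ F G g = record
  { dom = λ x → Σ (dom G x) λ d → Σ (dom g (app G x d)) λ e →
                  dom F (x , app g (app G x d) e)
  ; app = λ x dec → app F (x , app g (app G x (proj₁ dec)) (proj₁ (proj₂ dec)))
                             (proj₂ (proj₂ dec))
  ; irr = λ x dec dec' →
      appCong F
        (cong (x ,_) (appCong g (irr G x (proj₁ dec) (proj₁ dec'))
                                (proj₁ (proj₂ dec)) (proj₁ (proj₂ dec'))))
        (proj₂ (proj₂ dec)) (proj₂ (proj₂ dec'))
  }

Problem : Space → Space → Set₂
Problem X Y = PFun X Y → Set₁

_∈ₚ_ : {X Y : Space} → PFun X Y → Problem X Y → Set₁
f ∈ₚ P = Σ (PFun _ _) λ q → P q × (f ≈ₚ q)

-- (total) functions, as partial functions with full domain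
-- (a record wrapper so that the spaces can be inferred)
record Fun (X Y : Space) : Set where
  constructor fun
  field fn : Carrier X → Carrier Y

open Fun public

toPFun : {X Y : Space} → Fun X Y → PFun X Y
toPFun f = record { dom = λ _ → ⊤ ; app = λ x _ → fn f x ; irr = λ _ _ _ → refl }

⟦_⟧ : {X Y : Space} → Fun X Y → Problem X Y
⟦ f ⟧ p = Lift (suc zero) (p ≈ₚ toPFun f)

_≤₂_ : {X₁ Y₁ X₂ Y₂ : Space} → Problem X₁ Y₁ → Problem X₂ Y₂ → Set₁
_≤₂_ {X₁} {Y₁} {X₂} {Y₂} P Q =
  Σ (PFun (X₁ ⊗ Y₂) Y₁) λ F → Σ (PFun X₁ X₂) λ G →
  Continuous F × Continuous G ×
  ((g : PFun X₂ Y₂) → g ∈ₚ Q → compose₂ F G g ∈ₚ P)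

_≤₀_ : {X Y Z : Space} → Problem X Z → Problem Y Z → Set₁
_≤₀_ {X} {Y} {Z} P Q =
  Σ (PFun X Y) λ G → Continuous G ×
  ((g : PFun Y Z) → g ∈ₚ Q → (g ∘ₚ G) ∈ₚ P)

IsInfF₂ : {Xh Yh Xf Yf Xg Yg : Space} →
          Fun Xh Yh → Fun Xf Yf → Fun Xg Yg → Set₂
IsInfF₂ h f g =
  (⟦ h ⟧ ≤₂ ⟦ f ⟧) × (⟦ h ⟧ ≤₂ ⟦ g ⟧) ×
  (∀ {X Y : Space} (k : Fun X Y) → ⟦ k ⟧ ≤₂ ⟦ f ⟧ → ⟦ k ⟧ ≤₂ ⟦ g ⟧ → ⟦ k ⟧ ≤₂ ⟦ h ⟧)

IsInfP₂ : {Xp Yp Xa Ya Xb Yb : Space} →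
          Problem Xp Yp → Problem Xa Ya → Problem Xb Yb → Set₂
IsInfP₂ P A B =
  (P ≤₂ A) × (P ≤₂ B) ×
  (∀ {X Y : Space} (R : Problem X Y) → R ≤₂ A → R ≤₂ B → R ≤₂ P)

IsInfF₀ : {Xh Xf Xg Z : Space} → Fun Xh Z → Fun Xf Z → Fun Xg Z → Set₂
IsInfF₀ {Z = Z} h f g =
  (⟦ h ⟧ ≤₀ ⟦ f ⟧) × (⟦ h ⟧ ≤₀ ⟦ g ⟧) ×
  (∀ {X : Space} (k : Fun X Z) → ⟦ k ⟧ ≤₀ ⟦ f ⟧ → ⟦ k ⟧ ≤₀ ⟦ g ⟧ → ⟦ k ⟧ ≤₀ ⟦ h ⟧)

IsInfP₀ : {Xp Xa Xb Z : Space} →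
          Problem Xp Z → Problem Xa Z → Problem Xb Z → Set₂
IsInfP₀ {Z = Z} P A B =
  (P ≤₀ A) × (P ≤₀ B) ×
  (∀ {X : Space} (R : Problem X Z) → R ≤₀ A → R ≤₀ B → R ≤₀ P)

-- Consider the two-element problem
--   R = { ι₁ ∘ f ∘ π₁ , ι₂ ∘ g ∘ π₂ } : Xf × Xg → Yf ⊕ Yg
-- (for i = 0 simply { f ∘ π₁ , g ∘ π₂ } into the common codomain Z).
-- Plainly R ≤ᵢ {f} and R ≤ᵢ {g}.  If {h} were an infimum of {f} and {g}
-- among problems, then R ≤ᵢ {h}; the reduction turns h into one member of
-- R, so f ∘ π₁ ≤ᵢ h or g ∘ π₂ ≤ᵢ h.  Fixing a point of the other domain
-- gives f ≤ᵢ f ∘ π₁ (resp. g ≤ᵢ g ∘ π₂), hence f ≤ᵢ h ≤ᵢ g or g ≤ᵢ h ≤ᵢ f,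
-- contradicting incomparability.  Empty domains need no separate case:
-- a function on an empty space reduces to everything, so incomparability
-- rules empty domains out (constructively: their domains are ¬¬-inhabited).

module Submission where

open import Defs
open import Level using (lift)
open import Data.Unit using (⊤; tt)
open import Data.Empty using (⊥; ⊥-elim)
open import Data.Sum using (_⊎_; inj₁; inj₂; [_,_])
open import Data.Product using (Σ; _×_; _,_; proj₁; proj₂)
open import Relation.Nullary using (¬_)
open import Relation.Binary.PropositionalEquality using (_≡_; refl; trans; cong₂)

private
  variable
    A B C X Y Y₁ Y₂ Z Ya Yb Yc : Space

record _at_↦_ (p : PFun X Y) (x : Carrier X) (y : Carrier Y) : Set where
  constructor _,_
  field
    defined : dom p x
    value   : app p x defined ≡ y

Computes : PFun X Y → Fun X Y → Set
Computes p f = ∀ x → p at x ↦ fn f x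

≈-at : {p q : PFun X Y} {x : Carrier X} {y : Carrier Y} → p ≈ₚ q → q at x ↦ y → p at x ↦ y
≈-at {x = x} (same-dom , same-app) (d , e) =
  proj₂ (same-dom x) d , trans (same-app x (proj₂ (same-dom x) d) d) e

≈-refl : (p : PFun X Y) → p ≈ₚ p
≈-refl p = (λ _ → (λ d → d) , (λ d → d)) , irr p

∈⟦⟧⇒Computes : (p : PFun X Y) (f : Fun X Y) → p ∈ₚ ⟦ f ⟧ → Computes p f
∈⟦⟧⇒Computes p f (q , lift q≈f , p≈q) x = ≈-at {p = p} {q} p≈q (≈-at {p = q} {toPFun f} q≈f (tt , refl))

Computes⇒∈⟦⟧ : (p : PFun X Y) (f : Fun X Y) → Computes p f → p ∈ₚ ⟦ f ⟧
Computes⇒∈⟦⟧ p f p=f =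
  toPFun f , lift (≈-refl (toPFun f)) ,
  (λ x → (λ _ → tt) , (λ _ → _at_↦_.defined (p=f x))) ,
  (λ x d _ → trans (irr p x d _) (_at_↦_.value (p=f x)))

toPFun-∈⟦⟧ : (f : Fun X Y) → toPFun f ∈ₚ ⟦ f ⟧
toPFun-∈⟦⟧ f = Computes⇒∈⟦⟧ (toPFun f) f (λ _ → tt , refl)

∘-at : {G : PFun X Y} {g : PFun Y Z} {x : Carrier X} {w : Carrier Y} {v : Carrier Z} →
       G at x ↦ w → g at w ↦ v → (g ∘ₚ G) at x ↦ v
∘-at (dG , refl) (dg , refl) = (dG , dg) , refl

∘-at⁻¹ : (G : PFun X Y) (g : PFun Y Z) {x : Carrier X} {v : Carrier Z} →
         (g ∘ₚ G) at x ↦ v → Σ (Carrier Y) λ w → G at x ↦ w × g at w ↦ v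
∘-at⁻¹ _ _ ((dG , dg) , e) = _ , (dG , refl) , (dg , e)

compose₂-at : {F : PFun (X ⊗ Yb) Ya} {G : PFun X B} {g : PFun B Yb}
              {x : Carrier X} {w : Carrier B} {v : Carrier Yb} {y : Carrier Ya} →
              G at x ↦ w → g at w ↦ v → F at (x , v) ↦ y → compose₂ F G g at x ↦ y
compose₂-at (dG , refl) (dg , refl) (dF , refl) = (dG , dg , dF) , refl

compose₂-at⁻¹ : (F : PFun (X ⊗ Yb) Ya) (G : PFun X B) (g : PFun B Yb)
                {x : Carrier X} {y : Carrier Ya} → compose₂ F G g at x ↦ y →
                Σ (Carrier B) λ w → Σ (Carrier Yb) λ v →
                  G at x ↦ w × g at w ↦ v × F at (x , v) ↦ y
compose₂-at⁻¹ _ _ _ ((dG , dg , dF) , e) = _ , _ , (dG , refl) , (dg , refl) , (dF , e)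

computes-at : {q : PFun X Y} {f : Fun X Y} {x : Carrier X} {y : Carrier Y} →
              Computes q f → toPFun f at x ↦ y → q at x ↦ y
computes-at q=f (tt , refl) = q=f _

∘-replace : (G : PFun X Y) (q : PFun Y Z) {f : Fun Y Z} {x : Carrier X} {v : Carrier Z} →
            Computes q f → (toPFun f ∘ₚ G) at x ↦ v → (q ∘ₚ G) at x ↦ v
∘-replace G q {f} q=f fGx with ∘-at⁻¹ G (toPFun f) fGx
... | _ , Gx , fw = ∘-at Gx (computes-at q=f fw)

compose₂-replace : (F : PFun (X ⊗ Yb) Ya) (G : PFun X B) (q : PFun B Yb) {f : Fun B Yb}
                   {x : Carrier X} {y : Carrier Ya} →
                   Computes q f → compose₂ F G (toPFun f) at x ↦ y → compose₂ F G q at x ↦ y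
compose₂-replace F G q {f} q=f Ffx with compose₂-at⁻¹ F G (toPFun f) Ffx
... | _ , _ , Gx , fw , Fxv = compose₂-at Gx (computes-at q=f fw) Fxv

record _⇀_ (X Y : Space) : Set₁ where
  constructor cmap
  field
    map        : PFun X Y
    continuous : Continuous map

open _⇀_

record Preimage (F : PFun X Y) (V : Carrier Y → Set) : Set₁ where
  field
    set     : Carrier X → Set
    is-open : IsOpen X set
    into    : ∀ x d → V (app F x d) → set x
    out     : ∀ x d → set x → V (app F x d)

preimage : (F : X ⇀ Y) (V : Carrier Y → Set) → IsOpen Y V → Preimage (map F) V
preimage F V oV with continuous F V oV
... | U , oU , U=F⁻¹V = record
  { set = U ; is-open = oU ; into = λ x d → proj₁ (U=F⁻¹V x d) ; out = λ x d → proj₂ (U=F⁻¹V x d) }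

-- Constant predicates are open (as unions indexed by the predicate);
-- in particular the empty set is open.
constant-open : (X : Space) (P : Set) → IsOpen X (λ _ → P)
constant-open X P =
  open-ext X _ _ (λ _ → proj₁ , (λ p → p , tt)) (open-⋃ X P (λ _ _ → ⊤) (λ _ → open-whole X))

total : (Carrier X → Carrier Y) → PFun X Y
total φ = record { dom = λ _ → ⊤ ; app = λ x _ → φ x ; irr = λ _ _ _ → refl }

emptyᶜ : X ⇀ Y
emptyᶜ {X} = cmap (record { dom = λ _ → ⊥ ; app = λ _ () ; irr = λ _ () })
                  (λ _ _ → (λ _ → ⊤) , open-whole X , λ _ ())

idᶜ : X ⇀ X
idᶜ = cmap (total (λ x → x)) (λ V oV → V , oV , λ _ _ → (λ v → v) , (λ v → v))

constᶜ : Carrier Y → X ⇀ Y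
constᶜ {X = X} y = cmap (total (λ _ → y))
  (λ V _ → (λ _ → V y) , constant-open X (V y) , λ _ _ → (λ v → v) , (λ v → v))

fstᶜ : (X ⊗ Y) ⇀ X
fstᶜ {X} {Y} = cmap (total proj₁)
  (λ V oV → (λ z → V (proj₁ z)) ,
            (λ z v → V , (λ _ → ⊤) , oV , open-whole Y , v , tt , λ _ _ a _ → a) ,
            λ _ _ → (λ v → v) , (λ v → v))

sndᶜ : (X ⊗ Y) ⇀ Y
sndᶜ {X} {Y} = cmap (total proj₂)
  (λ V oV → (λ z → V (proj₂ z)) ,
            (λ z v → (λ _ → ⊤) , V , open-whole X , oV , tt , v , λ _ _ _ b → b) ,
            λ _ _ → (λ v → v) , (λ v → v))

_∘ᶜ_ : Y ⇀ Z → X ⇀ Y → X ⇀ Z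
g ∘ᶜ G = cmap (map g ∘ₚ map G) continuity
  where
  continuity : Continuous (map g ∘ₚ map G)
  continuity V oV = Preimage.set T , Preimage.is-open T , λ x (dG , dg) →
      (λ v → Preimage.into T x dG (Preimage.into U _ dg v)) ,
      (λ t → Preimage.out U _ dg (Preimage.out T x dG t))
    where
    U : Preimage (map g) V
    U = preimage g V oV
    T : Preimage (map G) (Preimage.set U)
    T = preimage G (Preimage.set U) (Preimage.is-open U)

record Rectangle (Y₁ Y₂ : Space) (W : Carrier (Y₁ ⊗ Y₂) → Set) (z : Carrier (Y₁ ⊗ Y₂)) : Set₁ where
  field
    S      : Carrier Y₁ → Set
    T      : Carrier Y₂ → Set
    S-open : IsOpen Y₁ S
    T-open : IsOpen Y₂ T
    ∈S     : S (proj₁ z)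
    ∈T     : T (proj₂ z)
    ⊆W     : ∀ a b → S a → T b → W (a , b)

rectangle : {W : Carrier (Y₁ ⊗ Y₂) → Set} → IsOpen (Y₁ ⊗ Y₂) W →
            ∀ z → W z → Rectangle Y₁ Y₂ W z
rectangle oW z w with oW z w
... | S , T , oS , oT , s , t , sub = record
  { S = S ; T = T ; S-open = oS ; T-open = oT ; ∈S = s ; ∈T = t ; ⊆W = sub }

-- Pairing.  An open W is the union of the rectangles S_z × T_z around its
-- points z, and the preimage of S_z × T_z under ⟨P , Q⟩ is P⁻¹S_z ∩ Q⁻¹T_z.
⟨_,_⟩ᶜ : X ⇀ Y₁ → X ⇀ Y₂ → X ⇀ (Y₁ ⊗ Y₂)
⟨_,_⟩ᶜ {X} {Y₁} {Y₂} P Q = cmap PQ continuity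
  where
  PQ : PFun X (Y₁ ⊗ Y₂)
  PQ = record
    { dom = λ x → dom (map P) x × dom (map Q) x
    ; app = λ x d → app (map P) x (proj₁ d) , app (map Q) x (proj₂ d)
    ; irr = λ x d d' → cong₂ _,_ (irr (map P) x _ _) (irr (map Q) x _ _)
    }
  continuity : Continuous PQ
  continuity W oW = ⋃U , open-⋃ X I U U-open , λ x d → into x d , out x d
    where
    I : Set
    I = Σ (Carrier (Y₁ ⊗ Y₂)) W
    R : (i : I) → Rectangle Y₁ Y₂ W (proj₁ i)
    R (z , w) = rectangle oW z w
    P⁻¹S : (i : I) → Preimage (map P) (Rectangle.S (R i))
    P⁻¹S i = preimage P _ (Rectangle.S-open (R i))
    Q⁻¹T : (i : I) → Preimage (map Q) (Rectangle.T (R i))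
    Q⁻¹T i = preimage Q _ (Rectangle.T-open (R i))
    U : I → Carrier X → Set
    U i x = Preimage.set (P⁻¹S i) x × Preimage.set (Q⁻¹T i) x
    U-open : ∀ i → IsOpen X (U i)
    U-open i = open-∩ X _ _ (Preimage.is-open (P⁻¹S i)) (Preimage.is-open (Q⁻¹T i))
    ⋃U : Carrier X → Set
    ⋃U x = Σ I λ i → U i x
    into : ∀ x d → W (app PQ x d) → ⋃U x
    into x (dP , dQ) w = i , Preimage.into (P⁻¹S i) x dP (Rectangle.∈S (R i)) ,
                             Preimage.into (Q⁻¹T i) x dQ (Rectangle.∈T (R i))
      where
      i : I
      i = (app PQ x (dP , dQ) , w)
    out : ∀ x d → ⋃U x → W (app PQ x d)
    out x (dP , dQ) (i , uP , uQ) =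
      Rectangle.⊆W (R i) _ _ (Preimage.out (P⁻¹S i) x dP uP) (Preimage.out (Q⁻¹T i) x dQ uQ)

pair-at : {P : X ⇀ Y₁} {Q : X ⇀ Y₂} {x : Carrier X} {a : Carrier Y₁} {b : Carrier Y₂} →
          map P at x ↦ a → map Q at x ↦ b → map ⟨ P , Q ⟩ᶜ at x ↦ (a , b)
pair-at (dP , refl) (dQ , refl) = (dP , dQ) , refl

_⊕_ : Space → Space → Space
Y₁ ⊕ Y₂ = record
  { Carrier    = Carrier Y₁ ⊎ Carrier Y₂
  ; IsOpen     = λ U → IsOpen Y₁ (λ a → U (inj₁ a)) × IsOpen Y₂ (λ b → U (inj₂ b))
  ; open-ext   = λ U V U=V oU → open-ext Y₁ _ _ (λ a → U=V (inj₁ a)) (proj₁ oU) ,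
                                open-ext Y₂ _ _ (λ b → U=V (inj₂ b)) (proj₂ oU)
  ; open-whole = open-whole Y₁ , open-whole Y₂
  ; open-∩     = λ U V oU oV → open-∩ Y₁ _ _ (proj₁ oU) (proj₁ oV) ,
                               open-∩ Y₂ _ _ (proj₂ oU) (proj₂ oV)
  ; open-⋃     = λ I U oU → open-⋃ Y₁ I _ (λ i → proj₁ (oU i)) ,
                            open-⋃ Y₂ I _ (λ i → proj₂ (oU i))
  }

inj₁ᶜ : Y₁ ⇀ (Y₁ ⊕ Y₂)
inj₁ᶜ = cmap (total inj₁) (λ U oU → _ , proj₁ oU , λ _ _ → (λ u → u) , (λ u → u))

inj₂ᶜ : Y₂ ⇀ (Y₁ ⊕ Y₂)
inj₂ᶜ = cmap (total inj₂) (λ U oU → _ , proj₂ oU , λ _ _ → (λ u → u) , (λ u → u))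

-- The partial inverse of inj₁, defined exactly on the first summand; the
-- preimage of V is V placed in the first summand, open as the second part is empty.
unInj₁ᶜ : (Y₁ ⊕ Y₂) ⇀ Y₁
unInj₁ᶜ {Y₁} {Y₂} = cmap (record { dom = Left ; app = left ; irr = left-irr })
  (λ V oV → V ⊎∅ , (oV , constant-open Y₂ ⊥) , λ { (inj₁ a) _ → (λ v → v) , (λ v → v) })
  where
  Left : Carrier Y₁ ⊎ Carrier Y₂ → Set
  Left (inj₁ _) = ⊤
  Left (inj₂ _) = ⊥
  left : ∀ s → Left s → Carrier Y₁
  left (inj₁ a) _ = a
  left-irr : ∀ s (d d' : Left s) → left s d ≡ left s d'
  left-irr (inj₁ _) _ _ = refl
  _⊎∅ : (Carrier Y₁ → Set) → Carrier Y₁ ⊎ Carrier Y₂ → Set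
  (V ⊎∅) (inj₁ a) = V a
  (V ⊎∅) (inj₂ _) = ⊥

unInj₂ᶜ : (Y₁ ⊕ Y₂) ⇀ Y₂
unInj₂ᶜ {Y₁} {Y₂} = cmap (record { dom = Right ; app = right ; irr = right-irr })
  (λ V oV → ∅⊎ V , (constant-open Y₁ ⊥ , oV) , λ { (inj₂ b) _ → (λ v → v) , (λ v → v) })
  where
  Right : Carrier Y₁ ⊎ Carrier Y₂ → Set
  Right (inj₁ _) = ⊥
  Right (inj₂ _) = ⊤
  right : ∀ s → Right s → Carrier Y₂
  right (inj₂ b) _ = b
  right-irr : ∀ s (d d' : Right s) → right s d ≡ right s d'
  right-irr (inj₂ _) _ _ = refl
  ∅⊎_ : (Carrier Y₂ → Set) → Carrier Y₁ ⊎ Carrier Y₂ → Set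
  (∅⊎ V) (inj₁ _) = ⊥
  (∅⊎ V) (inj₂ b) = V b

_∪_ : Problem X Y → Problem X Y → Problem X Y
(P ∪ Q) p = P p ⊎ Q p

∈-∪ : {P Q : Problem X Y} (p : PFun X Y) → p ∈ₚ (P ∪ Q) → p ∈ₚ P ⊎ p ∈ₚ Q
∈-∪ _ (q , inj₁ q∈P , p≈q) = inj₁ (q , q∈P , p≈q)
∈-∪ _ (q , inj₂ q∈Q , p≈q) = inj₂ (q , q∈Q , p≈q)

∪-∈ˡ : {P Q : Problem X Y} (p : PFun X Y) → p ∈ₚ P → p ∈ₚ (P ∪ Q)
∪-∈ˡ _ (q , q∈P , p≈q) = q , inj₁ q∈P , p≈q

∪-∈ʳ : {P Q : Problem X Y} (p : PFun X Y) → p ∈ₚ Q → p ∈ₚ (P ∪ Q)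
∪-∈ʳ _ (q , q∈Q , p≈q) = q , inj₂ q∈Q , p≈q

_≼₀_ : Fun A Z → Fun B Z → Set₁
_≼₀_ {A} {B = B} a b = Σ (A ⇀ B) λ G → Computes (toPFun b ∘ₚ map G) a

≼₀-trans : {a : Fun A Z} {b : Fun B Z} {c : Fun C Z} → a ≼₀ b → b ≼₀ c → a ≼₀ c
≼₀-trans {b = b} {c} (G₁ , a=bG₁) (G₂ , b=cG₂) = G₂ ∘ᶜ G₁ , λ x → chain (a=bG₁ x)
  where
  chain : ∀ {x v} → (toPFun b ∘ₚ map G₁) at x ↦ v → (toPFun c ∘ₚ (map G₂ ∘ₚ map G₁)) at x ↦ v
  chain bG₁x with ∘-at⁻¹ (map G₁) (toPFun b) bG₁x
  ... | w , G₁x , (tt , refl) with ∘-at⁻¹ (map G₂) (toPFun c) (b=cG₂ w)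
  ... | _ , G₂w , cu = ∘-at (∘-at G₁x G₂w) cu

≼₀-from-empty : {a : Fun A Z} {b : Fun B Z} → ¬ Carrier A → a ≼₀ b
≼₀-from-empty A-empty = emptyᶜ , λ x → ⊥-elim (A-empty x)

≤₀-solution : {P : Problem A Z} (h : Fun B Z) → P ≤₀ ⟦ h ⟧ →
              Σ (A ⇀ B) λ G → (toPFun h ∘ₚ map G) ∈ₚ P
≤₀-solution h (G , cG , reduce) = cmap G cG , reduce (toPFun h) (toPFun-∈⟦⟧ h)

≤₀⇒≼₀ : {a : Fun A Z} {b : Fun B Z} → ⟦ a ⟧ ≤₀ ⟦ b ⟧ → a ≼₀ b
≤₀⇒≼₀ {a = a} {b} r with ≤₀-solution b r
... | G , bG∈⟦a⟧ = G , ∈⟦⟧⇒Computes _ a bG∈⟦a⟧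

≼₀⇒≤₀ : {a : Fun A Z} {b : Fun B Z} → a ≼₀ b → ⟦ a ⟧ ≤₀ ⟦ b ⟧
≼₀⇒≤₀ {a = a} (G , a=bG) = map G , continuous G , λ q q∈⟦b⟧ →
  Computes⇒∈⟦⟧ _ a λ x → ∘-replace (map G) q (∈⟦⟧⇒Computes q _ q∈⟦b⟧) (a=bG x)

≤₀-∪ˡ : {P Q : Problem A Z} {S : Problem B Z} → P ≤₀ S → (P ∪ Q) ≤₀ S
≤₀-∪ˡ (G , cG , reduce) = G , cG , λ s s∈S → ∪-∈ˡ (s ∘ₚ G) (reduce s s∈S)

≤₀-∪ʳ : {P Q : Problem A Z} {S : Problem B Z} → Q ≤₀ S → (P ∪ Q) ≤₀ S
≤₀-∪ʳ (G , cG , reduce) = G , cG , λ s s∈S → ∪-∈ʳ (s ∘ₚ G) (reduce s s∈S)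

∪-split₀ : {a b : Fun A Z} {h : Fun B Z} → (⟦ a ⟧ ∪ ⟦ b ⟧) ≤₀ ⟦ h ⟧ → a ≼₀ h ⊎ b ≼₀ h
∪-split₀ {a = a} {b} {h} r with ≤₀-solution h r
... | G , hG∈a∪b = [ (λ hG∈⟦a⟧ → inj₁ (G , ∈⟦⟧⇒Computes _ a hG∈⟦a⟧)) ,
                     (λ hG∈⟦b⟧ → inj₂ (G , ∈⟦⟧⇒Computes _ b hG∈⟦b⟧)) ] (∈-∪ (toPFun h ∘ₚ map G) hG∈a∪b)

_≼₂_ : Fun A Ya → Fun B Yb → Set₁
_≼₂_ {A} {Ya} {B} {Yb} a b =
  Σ ((A ⊗ Yb) ⇀ Ya) λ F → Σ (A ⇀ B) λ G → Computes (compose₂ (map F) (map G) (toPFun b)) a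

-- A factorisation a = r ∘ b ∘ s through continuous maps is a ≤₂-reduction
-- whose post-processing ignores the original input.
≼₂-factor : {a : Fun A Ya} {b : Fun B Yb} (r : Yb ⇀ Ya) (s : A ⇀ B) →
            Computes (map r ∘ₚ (toPFun b ∘ₚ map s)) a → a ≼₂ b
≼₂-factor {A} {Yb = Yb} {b = b} r s a=rbs = r ∘ᶜ sndᶜ {A} {Yb} , s , λ x → reassociate (a=rbs x)
  where
  reassociate : ∀ {x y} → (map r ∘ₚ (toPFun b ∘ₚ map s)) at x ↦ y →
                compose₂ (map (r ∘ᶜ sndᶜ {A} {Yb})) (map s) (toPFun b) at x ↦ y
  reassociate (((ds , tt) , dr) , e) = (ds , tt , (tt , dr)) , e

-- Transitivity: with a x = F₁ (x , b (G₁ x)) and b w = F₂ (w , c (G₂ w)),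
-- a x = F₁ (x , F₂ (G₁ x , c (G₂ (G₁ x)))).
≼₂-trans : {a : Fun A Ya} {b : Fun B Yb} {c : Fun C Yc} → a ≼₂ b → b ≼₂ c → a ≼₂ c
≼₂-trans {A} {Ya} {B} {Yb} {Yc = Yc} {b = b} {c = c} (F₁ , G₁ , a=F₁bG₁) (F₂ , G₂ , b=F₂cG₂) =
  F , G₂ ∘ᶜ G₁ , λ x → chain (a=F₁bG₁ x)
  where
  π₁ : (A ⊗ Yc) ⇀ A
  π₁ = fstᶜ {A} {Yc}
  π₂ : (A ⊗ Yc) ⇀ Yc
  π₂ = sndᶜ {A} {Yc}
  shift : (A ⊗ Yc) ⇀ (B ⊗ Yc)
  shift = ⟨ G₁ ∘ᶜ π₁ , π₂ ⟩ᶜ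
  inner : (A ⊗ Yc) ⇀ (A ⊗ Yb)
  inner = ⟨ π₁ , F₂ ∘ᶜ shift ⟩ᶜ
  F : (A ⊗ Yc) ⇀ Ya
  F = F₁ ∘ᶜ inner
  chain : ∀ {x y} → compose₂ (map F₁) (map G₁) (toPFun b) at x ↦ y →
          compose₂ (map F) (map (G₂ ∘ᶜ G₁)) (toPFun c) at x ↦ y
  chain F₁bG₁x with compose₂-at⁻¹ (map F₁) (map G₁) (toPFun b) F₁bG₁x
  ... | w , _ , G₁x , (tt , refl) , F₁x with compose₂-at⁻¹ (map F₂) (map G₂) (toPFun c) (b=F₂cG₂ w)
  ... | u , _ , G₂w , (tt , refl) , F₂w =
    compose₂-at (∘-at G₁x G₂w) (tt , refl)
      (∘-at (pair-at {P = π₁} {Q = F₂ ∘ᶜ shift} (tt , refl)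
                     (∘-at (pair-at {P = G₁ ∘ᶜ π₁} {Q = π₂} (∘-at (tt , refl) G₁x) (tt , refl)) F₂w))
            F₁x)

≼₂-from-empty : {a : Fun A Ya} {b : Fun B Yb} → ¬ Carrier A → a ≼₂ b
≼₂-from-empty A-empty = emptyᶜ , emptyᶜ , λ x → ⊥-elim (A-empty x)

≤₂-solution : {P : Problem A Ya} (h : Fun B Yb) → P ≤₂ ⟦ h ⟧ →
              Σ ((A ⊗ Yb) ⇀ Ya) λ F → Σ (A ⇀ B) λ G → compose₂ (map F) (map G) (toPFun h) ∈ₚ P
≤₂-solution h (F , G , cF , cG , reduce) = cmap F cF , cmap G cG , reduce (toPFun h) (toPFun-∈⟦⟧ h)

≤₂⇒≼₂ : {a : Fun A Ya} {b : Fun B Yb} → ⟦ a ⟧ ≤₂ ⟦ b ⟧ → a ≼₂ b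
≤₂⇒≼₂ {a = a} {b} r with ≤₂-solution b r
... | F , G , Fb∈⟦a⟧ = F , G , ∈⟦⟧⇒Computes _ a Fb∈⟦a⟧

≼₂⇒≤₂ : {a : Fun A Ya} {b : Fun B Yb} → a ≼₂ b → ⟦ a ⟧ ≤₂ ⟦ b ⟧
≼₂⇒≤₂ {a = a} (F , G , a=FbG) = map F , map G , continuous F , continuous G , λ q q∈⟦b⟧ →
  Computes⇒∈⟦⟧ _ a λ x → compose₂-replace (map F) (map G) q (∈⟦⟧⇒Computes q _ q∈⟦b⟧) (a=FbG x)

≤₂-∪ˡ : {P Q : Problem A Ya} {S : Problem B Yb} → P ≤₂ S → (P ∪ Q) ≤₂ S
≤₂-∪ˡ (F , G , cF , cG , reduce) = F , G , cF , cG , λ s s∈S → ∪-∈ˡ (compose₂ F G s) (reduce s s∈S)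

≤₂-∪ʳ : {P Q : Problem A Ya} {S : Problem B Yb} → Q ≤₂ S → (P ∪ Q) ≤₂ S
≤₂-∪ʳ (F , G , cF , cG , reduce) = F , G , cF , cG , λ s s∈S → ∪-∈ʳ (compose₂ F G s) (reduce s s∈S)

∪-split₂ : {a b : Fun A Ya} {h : Fun B Yb} → (⟦ a ⟧ ∪ ⟦ b ⟧) ≤₂ ⟦ h ⟧ → a ≼₂ h ⊎ b ≼₂ h
∪-split₂ {a = a} {b} {h} r with ≤₂-solution h r
... | F , G , Fh∈a∪b = [ (λ Fh∈⟦a⟧ → inj₁ (F , G , ∈⟦⟧⇒Computes _ a Fh∈⟦a⟧)) ,
                         (λ Fh∈⟦b⟧ → inj₂ (F , G , ∈⟦⟧⇒Computes _ b Fh∈⟦b⟧)) ]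
                       (∈-∪ (compose₂ (map F) (map G) (toPFun h)) Fh∈a∪b)

along₁ : Fun A Z → (B : Space) → Fun (A ⊗ B) Z
along₁ f B = fun λ z → fn f (proj₁ z)

along₂ : (A : Space) → Fun B Z → Fun (A ⊗ B) Z
along₂ A g = fun λ z → fn g (proj₂ z)

-- The projections reduce f ∘ π₁ to f; a point of B gives a section of π₁,
-- reducing f back to f ∘ π₁ (symmetrically for π₂).
along₁≼₀ : (f : Fun A Z) (B : Space) → along₁ f B ≼₀ f
along₁≼₀ {A} f B = fstᶜ {A} {B} , λ _ → (tt , tt) , refl

along₂≼₀ : (A : Space) (g : Fun B Z) → along₂ A g ≼₀ g
along₂≼₀ {B} A g = sndᶜ {A} {B} , λ _ → (tt , tt) , refl

≼₀along₁ : (f : Fun A Z) (B : Space) → Carrier B → f ≼₀ along₁ f B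
≼₀along₁ {A} f B y = ⟨_,_⟩ᶜ {Y₁ = A} {B} idᶜ (constᶜ y) , λ _ → ((tt , tt) , tt) , refl

≼₀along₂ : (A : Space) (g : Fun B Z) → Carrier A → g ≼₀ along₂ A g
≼₀along₂ {B} A g x = ⟨_,_⟩ᶜ {Y₁ = A} {B} (constᶜ x) idᶜ , λ _ → ((tt , tt) , tt) , refl

tagged₁ : Fun A Y₁ → (B Y₂ : Space) → Fun (A ⊗ B) (Y₁ ⊕ Y₂)
tagged₁ f B Y₂ = fun λ z → inj₁ (fn f (proj₁ z))

tagged₂ : (A Y₁ : Space) → Fun B Y₂ → Fun (A ⊗ B) (Y₁ ⊕ Y₂)
tagged₂ A Y₁ g = fun λ z → inj₂ (fn g (proj₂ z))

-- Tagging is undone by the partial inverse of the injection, so as for ≤₀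
-- the tagged function is ≤₂-equivalent to f once B has a point.
tagged₁≼₂ : (f : Fun A Y₁) (B Y₂ : Space) → tagged₁ f B Y₂ ≼₂ f
tagged₁≼₂ {A} {Y₁} f B Y₂ = ≼₂-factor (inj₁ᶜ {Y₁} {Y₂}) (fstᶜ {A} {B}) λ _ → ((tt , tt) , tt) , refl

tagged₂≼₂ : (A Y₁ : Space) (g : Fun B Y₂) → tagged₂ A Y₁ g ≼₂ g
tagged₂≼₂ {B} {Y₂} A Y₁ g = ≼₂-factor (inj₂ᶜ {Y₂} {Y₁}) (sndᶜ {A} {B}) λ _ → ((tt , tt) , tt) , refl

≼₂tagged₁ : (f : Fun A Y₁) (B Y₂ : Space) → Carrier B → f ≼₂ tagged₁ f B Y₂
≼₂tagged₁ {A} {Y₁} f B Y₂ y =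
  ≼₂-factor (unInj₁ᶜ {Y₁} {Y₂}) (⟨_,_⟩ᶜ {Y₁ = A} {B} idᶜ (constᶜ y)) λ _ → (((tt , tt) , tt) , tt) , refl

≼₂tagged₂ : (A Y₁ : Space) (g : Fun B Y₂) → Carrier A → g ≼₂ tagged₂ A Y₁ g
≼₂tagged₂ {B} {Y₂} A Y₁ g x =
  ≼₂-factor (unInj₂ᶜ {Y₁} {Y₂}) (⟨_,_⟩ᶜ {Y₁ = A} {B} (constᶜ x) idᶜ) λ _ → (((tt , tt) , tt) , tt) , refl

inhabited₀ : {a : Fun A Z} {b : Fun B Z} → ¬ (⟦ a ⟧ ≤₀ ⟦ b ⟧) → ¬ ¬ Carrier A
inhabited₀ a≰b A-empty = a≰b (≼₀⇒≤₀ (≼₀-from-empty A-empty))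

inhabited₂ : {a : Fun A Ya} {b : Fun B Yb} → ¬ (⟦ a ⟧ ≤₂ ⟦ b ⟧) → ¬ ¬ Carrier A
inhabited₂ a≰b A-empty = a≰b (≼₂⇒≤₂ (≼₂-from-empty A-empty))

-- The test problem {f ∘ π₁} ∪ {g ∘ π₂} lies below {f} and {g}, hence below
-- {h}, so f ≼ f ∘ π₁ ≼ h ≼ g or g ≼ g ∘ π₂ ≼ h ≼ f.
comparable₀ : {Xf Xg Xh : Space} {f : Fun Xf Z} {g : Fun Xg Z} {h : Fun Xh Z} →
              IsInfP₀ ⟦ h ⟧ ⟦ f ⟧ ⟦ g ⟧ → Carrier Xf → Carrier Xg →
              ⟦ f ⟧ ≤₀ ⟦ g ⟧ ⊎ ⟦ g ⟧ ≤₀ ⟦ f ⟧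
comparable₀ {Xf = Xf} {Xg} {f = f} {g} (h≤f , h≤g , greatest) x₀ y₀
  with ∪-split₀ (greatest (⟦ along₁ f Xg ⟧ ∪ ⟦ along₂ Xf g ⟧)
                          (≤₀-∪ˡ (≼₀⇒≤₀ (along₁≼₀ f Xg))) (≤₀-∪ʳ (≼₀⇒≤₀ (along₂≼₀ Xf g))))
... | inj₁ fπ₁≼h = inj₁ (≼₀⇒≤₀ (≼₀-trans (≼₀-trans (≼₀along₁ f Xg y₀) fπ₁≼h) (≤₀⇒≼₀ h≤g)))
... | inj₂ gπ₂≼h = inj₂ (≼₀⇒≤₀ (≼₀-trans (≼₀-trans (≼₀along₂ Xf g x₀) gπ₂≼h) (≤₀⇒≼₀ h≤f)))

comparable₂ : {Xf Yf Xg Yg Xh Yh : Space} {f : Fun Xf Yf} {g : Fun Xg Yg} {h : Fun Xh Yh} →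
              IsInfP₂ ⟦ h ⟧ ⟦ f ⟧ ⟦ g ⟧ → Carrier Xf → Carrier Xg →
              ⟦ f ⟧ ≤₂ ⟦ g ⟧ ⊎ ⟦ g ⟧ ≤₂ ⟦ f ⟧
comparable₂ {Xf} {Yf} {Xg} {Yg} {f = f} {g} (h≤f , h≤g , greatest) x₀ y₀
  with ∪-split₂ (greatest (⟦ tagged₁ f Xg Yg ⟧ ∪ ⟦ tagged₂ Xf Yf g ⟧)
                          (≤₂-∪ˡ (≼₂⇒≤₂ (tagged₁≼₂ f Xg Yg))) (≤₂-∪ʳ (≼₂⇒≤₂ (tagged₂≼₂ Xf Yf g))))
... | inj₁ fπ₁≼h = inj₁ (≼₂⇒≤₂ (≼₂-trans (≼₂-trans (≼₂tagged₁ f Xg Yg y₀) fπ₁≼h) (≤₂⇒≼₂ h≤g)))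
... | inj₂ gπ₂≼h = inj₂ (≼₂⇒≤₂ (≼₂-trans (≼₂-trans (≼₂tagged₂ Xf Yf g x₀) gπ₂≼h) (≤₂⇒≼₂ h≤f)))

-- Theorem 4.20.  Incomparability forces both domains to be (¬¬-)inhabited,
-- and then comparable₀ / comparable₂ contradict it.
theorem4p20 :
  (∀ {Xf Xg Xh Z : Space} (f : Fun Xf Z) (g : Fun Xg Z) (h : Fun Xh Z) →
     ¬ (⟦ f ⟧ ≤₀ ⟦ g ⟧) → ¬ (⟦ g ⟧ ≤₀ ⟦ f ⟧) →
     IsInfF₀ h f g → ¬ IsInfP₀ ⟦ h ⟧ ⟦ f ⟧ ⟦ g ⟧)
  ×
  (∀ {Xf Yf Xg Yg Xh Yh : Space} (f : Fun Xf Yf) (g : Fun Xg Yg) (h : Fun Xh Yh) →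
     ¬ (⟦ f ⟧ ≤₂ ⟦ g ⟧) → ¬ (⟦ g ⟧ ≤₂ ⟦ f ⟧) →
     IsInfF₂ h f g → ¬ IsInfP₂ ⟦ h ⟧ ⟦ f ⟧ ⟦ g ⟧)
theorem4p20 =
  (λ _ _ _ f≰g g≰f _ infimum →
     inhabited₀ f≰g λ x₀ → inhabited₀ g≰f λ y₀ → [ f≰g , g≰f ] (comparable₀ infimum x₀ y₀)) ,
  (λ _ _ _ f≰g g≰f _ infimum →
     inhabited₂ f≰g λ x₀ → inhabited₂ g≰f λ y₀ → [ f≰g , g≰f ] (comparable₂ infimum x₀ y₀))
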